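{- Let $q$ be a prime power and let $\mathcal{C}\subseteq\mathbb{F}_q^{m\times n}$ be an MRD code. Then for every nonzero vector $\mathbf{x}\in\mathbb{F}_q^m$ and every $\mathbf{y}\in\mathbb{F}_q^n$ there is at least one matrix $M\in\mathcal{C}$ such that $\mathbf{x}M=\mathbf{y}$.
   Context: Vectors are row vectors. For a code $\mathcal{C}\subseteq\mathbb{F}_q^{m\times n}$ with at least two elements, its minimum distance is $d=\min\{\mathrm{rk}(A-B):A,B\in\mathcal{C},A\neq B\}$; $\mathcal{C}$ is a maximum rank distance (MRD) code if $\#\mathcal{C}=q^{\max\{m,n\}(\min\{m,n\}-d+1)}$ (the Singleton bound). -}

module Defs where

open import Level using (Level; _⊔_)
open import Data.Nat using (ℕ; zero; suc; _≤_)
import Data.Nat as ℕ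
open import Data.Fin using (Fin; zero; suc)
import Data.Fin as Fin
open import Data.Product using (Σ; ∃; _×_; _,_)
open import Data.List using (List; length)
open import Data.List.Relation.Unary.Any using (Any)
open import Data.List.Relation.Unary.AllPairs using (AllPairs)
open import Data.Nat.Primality using (Prime)
open import Relation.Binary.PropositionalEquality using (_≡_)
open import Relation.Nullary using (¬_)
open import Algebra.Bundles using (CommutativeRing)
open import Function.Definitions using (Injective)

record IsField {c ℓ : Level} (R : CommutativeRing c ℓ) : Set (c Level.⊔ ℓ) where
  open CommutativeRing R hiding (zero)
  field
    0≉1     : ¬ (0# ≈ 1#)
    inverse : ∀ x → ¬ (x ≈ 0#) → ∃ λ y → x * y ≈ 1#

record HasCard {c ℓ : Level} (R : CommutativeRing c ℓ) (q : ℕ) : Set (c Level.⊔ ℓ) where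
  open CommutativeRing R hiding (zero)
  field
    enum       : Fin q → Carrier
    enum-inj   : ∀ i j → enum i ≈ enum j → i ≡ j
    enum-surj  : ∀ x → ∃ λ i → enum i ≈ x

IsPrimePower : ℕ → Set
IsPrimePower q = Σ ℕ λ p → Σ ℕ λ k → Prime p × q ≡ p ℕ.^ suc k

module Matrices {c ℓ : Level} (R : CommutativeRing c ℓ) where
  open CommutativeRing R hiding (zero)

  Vector : ℕ → Set c
  Vector k = Fin k → Carrier

  Matrix : ℕ → ℕ → Set c
  Matrix m n = Fin m → Fin n → Carrier

  sumF : (k : ℕ) → (Fin k → Carrier) → Carrier
  sumF ℕ.zero  f = 0#
  sumF (suc k) f = f Fin.zero + sumF k (λ i → f (suc i))

  _≈V_ : ∀ {k} → Vector k → Vector k → Set ℓ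
  u ≈V v = ∀ i → u i ≈ v i

  _≈M_ : ∀ {m n} → Matrix m n → Matrix m n → Set ℓ
  A ≈M B = ∀ i j → A i j ≈ B i j

  zeroV : ∀ {k} → Vector k
  zeroV _ = 0#

  _-M_ : ∀ {m n} → Matrix m n → Matrix m n → Matrix m n
  (A -M B) i j = A i j - B i j

  _·M_ : ∀ {m n} → Vector m → Matrix m n → Vector n
  (x ·M M) j = sumF _ (λ i → x i * M i j)

  LinIndep : ∀ {k n} → (Fin k → Vector n) → Set (c Level.⊔ ℓ)
  LinIndep {k} {n} v =
    (a : Fin k → Carrier) → (λ j → sumF k (λ i → a i * v i j)) ≈V zeroV → ∀ i → a i ≈ 0#

  RankAtLeast : ∀ {m n} → Matrix m n → ℕ → Set (c Level.⊔ ℓ)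
  RankAtLeast {m} {n} A r =
    Σ (Fin r → Fin m) λ σ → Injective _≡_ _≡_ σ × LinIndep (λ i → A (σ i))

  HasRank : ∀ {m n} → Matrix m n → ℕ → Set (c Level.⊔ ℓ)
  HasRank A r = RankAtLeast A r × ¬ RankAtLeast A (suc r)

  -- A code: a duplicate-free list of m×n matrices (membership up to ≈M)
  _∈C_ : ∀ {m n} → Matrix m n → List (Matrix m n) → Set (c Level.⊔ ℓ)
  A ∈C C = Any (λ B → A ≈M B) C

  Distinct : ∀ {m n} → List (Matrix m n) → Set (c Level.⊔ ℓ)
  Distinct C = AllPairs (λ A B → ¬ (A ≈M B)) C

  MinDist : ∀ {m n} → List (Matrix m n) → ℕ → Set (c Level.⊔ ℓ)
  MinDist C d =
    (Σ _ λ A → Σ _ λ B → A ∈C C × B ∈C C × ¬ (A ≈M B) × HasRank (A -M B) d)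
    × (∀ A B r → A ∈C C → B ∈C C → ¬ (A ≈M B) → HasRank (A -M B) r → d ≤ r)

  IsMRD : (q m n : ℕ) → List (Matrix m n) → Set (c Level.⊔ ℓ)
  IsMRD q m n C = Distinct C × Σ ℕ λ d →
    MinDist C d × length C ≡ q ℕ.^ ((m ℕ.⊔ n) ℕ.* ((m ℕ.⊓ n) ℕ.∸ d ℕ.+ 1))

module Submission where

-- Let d = e + 1 be the minimum distance and k = min(m,n) − d, so that |C| = q^(max(m,n)(k+1)).
-- Two codewords agreeing on too much data differ by a matrix of rank ≤ e, hence are equal.
-- If m ≤ n, the map M ↦ (x M, k rows of M other than a pivot row of x) is therefore injective
-- on C; its target also has q^(n(k+1)) elements, so it is onto and some codeword has x M = y.
-- If n < m, the same argument with M ↦ (M a, k columns of M) shows that for every a ≠ 0 at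
-- least |C|/q codewords satisfy (x M)·a = y·a. If no codeword had x M = y, each would satisfy
-- this for only q^(n−1) vectors a, and counting the pairs (a , M) both ways is contradictory.

open import Level using (Level)
open import Data.Nat using (ℕ)
open import Data.Product using (Σ; _×_)
open import Data.List using (List)
open import Relation.Nullary using (¬_)
open import Algebra.Bundles using (CommutativeRing)
open import Defs

module Counting where

  open import Data.Empty using (⊥; ⊥-elim)
  open import Data.Nat using (zero; suc; _+_; _*_; _≤_; _<_; z≤n; s≤s)
  open import Data.Nat.Properties
  open import Data.Fin using (Fin; zero; suc)
  open import Data.Fin.Properties using (injective⇒≤)
  open import Data.Product using (∃; _,_)
  open import Data.Bool using (true; false; if_then_else_)
  open import Data.List using ([]; _∷_; length; lookup; filter; map; _++_)
  open import Data.Nat.ListAction using (sum)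
  open import Data.List.Properties using (length-++; filter-++; filter-all)
  open import Data.List.Relation.Unary.Any as Any using (Any; here; there)
  open import Data.List.Relation.Unary.Any.Properties using (lookup-index)
  open import Data.List.Relation.Unary.All as All using (All; []; _∷_)
  open import Data.List.Relation.Unary.AllPairs using (AllPairs; []; _∷_)
  open import Data.List.Membership.Propositional.Properties using (∈-lookup)
  import Data.List.Membership.Setoid.Properties as SetoidMembershipₚ
  import Data.List.Relation.Unary.Unique.Setoid as SetoidUnique
  import Data.List.Relation.Unary.Unique.Setoid.Properties as SetoidUniqueₚ
  open import Data.List.Relation.Binary.Subset.Setoid using (_⊆_)
  open import Function.Definitions using (Injective)
  open import Relation.Binary.Bundles using (Setoid)
  open import Relation.Binary.Definitions using (_Respects_)
  open import Relation.Binary.PropositionalEquality using (_≡_; refl; cong; sym; trans; subst)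
  open import Relation.Nullary using (Dec; does; yes; no)
  open import Algebra.Properties.CommutativeSemigroup +-commutativeSemigroup using (x∙yz≈y∙xz)
  open import Relation.Unary using (Pred; Decidable; ∁)
  open import Relation.Unary.Properties using (∁?)

  private variable
    a p p′ r r′ : Level
    A : Set a

  count : {P : Pred A p} → Decidable P → List A → ℕ
  count P? xs = length (filter P? xs)

  count-const : ∀ {Q : Set p} (Q? : Dec Q) (xs : List A) → count (λ _ → Q?) xs ≡ (if does Q? then length xs else 0)
  count-const Q? []       with does Q?
  ... | true  = refl
  ... | false = refl
  count-const Q? (x ∷ xs) with does Q? | count-const Q? xs
  ... | true  | ih = cong suc ih
  ... | false | ih = ih

  module _ {P : Pred A p} (P? : Decidable P) where

    count-complement : ∀ xs → count P? xs + count (∁? P?) xs ≡ length xs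
    count-complement []       = refl
    count-complement (x ∷ xs) with does (P? x)
    ... | true  = cong suc (count-complement xs)
    ... | false = trans (+-suc (count P? xs) _) (cong suc (count-complement xs))

    count-++ : ∀ xs ys → count P? (xs ++ ys) ≡ count P? xs + count P? ys
    count-++ xs ys = trans (cong length (filter-++ P? xs ys)) (length-++ (filter P? xs))

    count-map : {B : Set a} (f : B → A) → ∀ xs → count P? (map f xs) ≡ count (λ x → P? (f x)) xs
    count-map f []       = refl
    count-map f (x ∷ xs) with does (P? (f x))
    ... | true  = cong suc (count-map f xs)
    ... | false = count-map f xs

    count-all : (∀ x → P x) → ∀ xs → count P? xs ≡ length xs
    count-all always xs = cong length (filter-all P? (All.universal always xs))

    count-pos⇒Any : ∀ xs → 0 < count P? xs → Any P xs
    count-pos⇒Any (x ∷ xs) pos with P? x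
    ... | yes px = here px
    ... | no  _  = there (count-pos⇒Any xs pos)

    Any⇒count-pos : ∀ {xs} → Any P xs → 0 < count P? xs
    Any⇒count-pos {x ∷ xs} (here px) with P? x
    ... | yes _   = s≤s z≤n
    ... | no ¬px  = ⊥-elim (¬px px)
    Any⇒count-pos {x ∷ xs} (there pxs) with does (P? x)
    ... | true  = s≤s z≤n
    ... | false = Any⇒count-pos pxs

    module _ {Q : Pred A p′} (Q? : Decidable Q) where

      count-mono : (∀ x → P x → Q x) → ∀ xs → count P? xs ≤ count Q? xs
      count-mono P⇒Q []       = z≤n
      count-mono P⇒Q (x ∷ xs) with P? x | Q? x
      ... | yes _  | yes _  = s≤s (count-mono P⇒Q xs)
      ... | yes px | no ¬qx = ⊥-elim (¬qx (P⇒Q x px))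
      ... | no _   | yes _  = m≤n⇒m≤1+n (count-mono P⇒Q xs)
      ... | no _   | no _   = count-mono P⇒Q xs

  AllPairs-map-under-All : {P : Pred A p} {R : A → A → Set r} {R′ : A → A → Set r′} →
                           (∀ {x y} → P x → P y → R x y → R′ x y) →
                           ∀ {xs} → All P xs → AllPairs R xs → AllPairs R′ xs
  AllPairs-map-under-All imp []         []         = []
  AllPairs-map-under-All {P = P} {R} {R′} imp {x ∷ _} (px ∷ pxs) (rx ∷ rxs) =
    row pxs rx ∷ AllPairs-map-under-All imp pxs rxs
    where
    row : ∀ {ys} → All P ys → All (R x) ys → All (R′ x) ys
    row []         []       = []
    row (py ∷ pys) (r ∷ rs) = imp px py r ∷ row pys rs

  module _ {c ℓ} (S : Setoid c ℓ) where
    open Setoid S using (Carrier; _≈_; reflexive) renaming (sym to ≈-sym; trans to ≈-trans)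
    open SetoidUnique S using (Unique)

    Unique-lookup-injective : ∀ {xs} → Unique xs → ∀ {i j} → lookup xs i ≈ lookup xs j → i ≡ j
    Unique-lookup-injective (_  ∷ _)   {zero}  {zero}  _  = refl
    Unique-lookup-injective (x∉ ∷ _)   {zero}  {suc j} eq = ⊥-elim (All.lookup x∉ (∈-lookup j) eq)
    Unique-lookup-injective (x∉ ∷ _)   {suc i} {zero}  eq = ⊥-elim (All.lookup x∉ (∈-lookup i) (≈-sym eq))
    Unique-lookup-injective (_  ∷ xs!) {suc i} {suc j} eq = cong suc (Unique-lookup-injective xs! eq)

    -- Pigeonhole: send the i-th element of xs to the position of one of its copies in ys.
    Unique-⊆⇒length≤ : ∀ {xs ys} → Unique xs → _⊆_ S xs ys → length xs ≤ length ys
    Unique-⊆⇒length≤ {xs} {ys} xs! xs⊆ys = injective⇒≤ position-injective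
      where
      position : Fin (length xs) → Fin (length ys)
      position i = Any.index (xs⊆ys (SetoidMembershipₚ.∈-lookup S xs i))

      lookup-position : ∀ i → lookup xs i ≈ lookup ys (position i)
      lookup-position i = lookup-index (xs⊆ys (SetoidMembershipₚ.∈-lookup S xs i))

      position-injective : Injective _≡_ _≡_ position
      position-injective {i} {j} eq = Unique-lookup-injective xs!
        (≈-trans (lookup-position i) (≈-trans (reflexive (cong (lookup ys) eq)) (≈-sym (lookup-position j))))

    count-mono-⊆ : {P : Pred Carrier p} (P? : Decidable P) → P Respects _≈_ →
                   ∀ {xs ys} → Unique xs → _⊆_ S xs ys → count P? xs ≤ count P? ys
    count-mono-⊆ P? resp {xs} {ys} xs! xs⊆ys = Unique-⊆⇒length≤ (SetoidUniqueₚ.filter⁺ S P? xs!) filter-⊆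
      where
      filter-⊆ : _⊆_ S (filter P? xs) (filter P? ys)
      filter-⊆ v∈ with v∈xs , pv ← SetoidMembershipₚ.∈-filter⁻ S P? resp v∈ =
        SetoidMembershipₚ.∈-filter⁺ S P? resp (xs⊆ys v∈xs) pv

    count-antimono-⊆ : {P : Pred Carrier p} (P? : Decidable P) → P Respects _≈_ →
                       ∀ {xs ys} → Unique xs → _⊆_ S xs ys → length ys ≤ length xs →
                       count P? ys ≤ count P? xs
    count-antimono-⊆ {P = P} P? resp {xs} {ys} xs! xs⊆ys ys≤xs =
      +-cancelʳ-≤ (count (∁? P?) ys) _ _ (begin
        count P? ys + count (∁? P?) ys ≡⟨ count-complement P? ys ⟩
        length ys                       ≤⟨ ys≤xs ⟩
        length xs                       ≡⟨ sym (count-complement P? xs) ⟩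
        count P? xs + count (∁? P?) xs ≤⟨ +-monoʳ-≤ (count P? xs) (count-mono-⊆ (∁? P?) ∁-resp xs! xs⊆ys) ⟩
        count P? xs + count (∁? P?) ys ∎)
      where
      open ≤-Reasoning
      ∁-resp : ∁ P Respects _≈_
      ∁-resp x≈y ¬px py = ¬px (resp (≈-sym x≈y) py)

  module _ {f : A → ℕ} where

    sum-map-≤ : ∀ {c xs} → All (λ x → f x ≤ c) xs → sum (map f xs) ≤ length xs * c
    sum-map-≤ []           = z≤n
    sum-map-≤ (fx≤c ∷ fxs) = +-mono-≤ fx≤c (sum-map-≤ fxs)

    sum-map-≥ : ∀ {b} → (∀ x → b ≤ f x) → ∀ xs → length xs * b ≤ sum (map f xs)
    sum-map-≥ b≤f []       = z≤n
    sum-map-≥ b≤f (x ∷ xs) = +-mono-≤ (b≤f x) (sum-map-≥ b≤f xs)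

    sum-map-≥-with-excess : ∀ {b c} → (∀ x → b ≤ f x) → ∀ {xs} → Any (λ x → b + c ≤ f x) xs →
                            length xs * b + c ≤ sum (map f xs)
    sum-map-≥-with-excess {b} {c} b≤f {x ∷ xs} (here b+c≤fx) = begin
      (b + length xs * b) + c ≡⟨ +-assoc b _ c ⟩
      b + (length xs * b + c) ≡⟨ cong (b +_) (+-comm _ c) ⟩
      b + (c + length xs * b) ≡⟨ sym (+-assoc b c _) ⟩
      (b + c) + length xs * b ≤⟨ +-mono-≤ b+c≤fx (sum-map-≥ b≤f xs) ⟩
      f x + sum (map f xs)    ∎
      where open ≤-Reasoning
    sum-map-≥-with-excess {b} {c} b≤f {x ∷ xs} (there excess) = begin
      (b + length xs * b) + c ≡⟨ +-assoc b _ c ⟩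
      b + (length xs * b + c) ≤⟨ +-mono-≤ (b≤f x) (sum-map-≥-with-excess b≤f excess) ⟩
      f x + sum (map f xs)    ∎
      where open ≤-Reasoning

  sum-count-swap : {B : Set a} {R : A → B → Set r} (R? : ∀ x y → Dec (R x y)) →
                   ∀ xs ys → sum (map (λ x → count (R? x) ys) xs) ≡ sum (map (λ y → count (λ x → R? x y) xs) ys)
  sum-count-swap R? []       ys = sym (sum-zeros ys)
    where
    sum-zeros : ∀ ys → sum (map (λ _ → 0) ys) ≡ 0
    sum-zeros []       = refl
    sum-zeros (_ ∷ ys) = sum-zeros ys
  sum-count-swap {B = B} R? (x ∷ xs) ys = trans (cong (count (R? x) ys +_) (sum-count-swap R? xs ys)) (add-row ys)
    where
    column : B → ℕ
    column y = count (λ x → R? x y) xs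
    add-row : ∀ ys → count (R? x) ys + sum (map column ys) ≡ sum (map (λ y → count (λ x → R? x y) (x ∷ xs)) ys)
    add-row []       = refl
    add-row (y ∷ ys) with does (R? x y)
    ... | true  = cong suc (trans (x∙yz≈y∙xz (count (R? x) ys) (column y) _) (cong (column y +_) (add-row ys)))
    ... | false = trans (x∙yz≈y∙xz (count (R? x) ys) (column y) _) (cong (column y +_) (add-row ys))

  ¬¬-last : ∀ {p} (P : ℕ → Set p) e → P 0 → (∀ s → P s → s ≤ e) → ¬ ¬ ∃ λ r → P r × ¬ P (suc r)
  ¬¬-last P e P0 bounded no-last = climb (suc e) 0 P0 ≤-refl
    where
    climb : ∀ n k → P k → suc e ≤ k + n → ⊥
    climb zero    k Pk e<k = <⇒≱ (subst (suc e ≤_) (+-identityʳ k) e<k) (bounded k Pk)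
    climb (suc n) k Pk e<k = no-last (k , Pk , λ Pk+1 → climb n (suc k) Pk+1 (subst (suc e ≤_) (+-suc k n) e<k))

module Enumerations where

  open import Level using (_⊔_)
  open import Data.Nat using (zero; suc; _+_; _*_; _^_; _≤_)
  open import Data.Nat.Properties using (module ≤-Reasoning)
  open import Data.Fin using (zero; suc)
  open import Data.Product using (_,_)
  open import Data.List using ([]; _∷_; length; map; _++_; cartesianProductWith)
  open import Data.List.Properties using (length-++; length-map)
  open import Data.List.Relation.Unary.Any using (here)
  open import Data.List.Relation.Unary.AllPairs using (AllPairs; []; _∷_)
  import Data.List.Relation.Unary.AllPairs.Properties as AllPairsₚ
  open import Data.List.Relation.Unary.All using ([])
  open import Data.List.Relation.Unary.Enumerates.Setoid using (IsEnumeration)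
  import Data.List.Membership.Setoid.Properties as SetoidMembershipₚ
  import Data.List.Relation.Unary.Unique.Setoid as SetoidUnique
  import Data.List.Relation.Unary.Unique.Setoid.Properties as SetoidUniqueₚ
  open import Data.Vec.Functional using (Vector; head; tail) renaming ([] to []ᵛ; _∷_ to _∷ᵛ_)
  open import Data.Vec.Functional.Relation.Binary.Equality.Setoid using (≋-setoid)
  open import Relation.Binary.Bundles using (Setoid)
  open import Relation.Binary.PropositionalEquality as ≡ using (_≡_; refl; cong; cong₂; trans; module ≡-Reasoning)
  open import Relation.Binary.Definitions using (_Respects_)
  open import Data.Bool using (true; false; if_then_else_)
  open import Relation.Nullary using (does)
  open import Relation.Unary using (Pred; Decidable)

  open Counting

  record Enumeration {a ℓ} (S : Setoid a ℓ) : Set (a ⊔ ℓ) where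
    field
      elements : List (Setoid.Carrier S)
      unique   : SetoidUnique.Unique S elements
      complete : IsEnumeration S elements

    card : ℕ
    card = length elements

  open Enumeration public

  module _ {a ℓ} {S : Setoid a ℓ} (E : Enumeration S) where
    open Setoid S using () renaming (Carrier to A; refl to ≈-refl)

    private
      V : ℕ → Setoid a ℓ
      V = ≋-setoid S

    vectors : ∀ k → Enumeration (V k)
    elements (vectors zero)    = []ᵛ ∷ []
    elements (vectors (suc k)) = cartesianProductWith _∷ᵛ_ (elements E) (elements (vectors k))
    unique (vectors zero)      = [] ∷ []
    unique (vectors (suc k))   = SetoidUniqueₚ.cartesianProductWith⁺ S (V k) (V (suc k)) _∷ᵛ_
      (λ eq → eq zero , λ i → eq (suc i)) (unique E) (unique (vectors k))
    complete (vectors zero) v    = here (λ ())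
    complete (vectors (suc k)) v =
      SetoidMembershipₚ.∈-resp-≈ (V (suc k)) (λ { zero → ≈-refl ; (suc i) → ≈-refl })
        (SetoidMembershipₚ.∈-cartesianProductWith⁺ S (V k) (V (suc k))
          (λ { x≈y u≋v zero → x≈y ; x≈y u≋v (suc i) → u≋v i })
          (complete E (head v)) (complete (vectors k) (tail v)))

    card-vectors : ∀ k → card (vectors k) ≡ card E ^ k
    card-vectors zero    = refl
    card-vectors (suc k) = trans (length-product (elements E)) (cong (card E *_) (card-vectors k))
      where
      length-product : ∀ xs → length (cartesianProductWith _∷ᵛ_ xs (elements (vectors k))) ≡ length xs * card (vectors k)
      length-product []       = refl
      length-product (x ∷ xs) = trans (length-++ (map (x ∷ᵛ_) (elements (vectors k))))
        (cong₂ _+_ (length-map (x ∷ᵛ_) (elements (vectors k))) (length-product xs))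

    count-head : ∀ {p} {P : Pred A p} (P? : Decidable P) k →
                 count (λ v → P? (head v)) (elements (vectors (suc k))) ≡ count P? (elements E) * card (vectors k)
    count-head P? k = go (elements E)
      where
      vs : List (Vector A k)
      vs = elements (vectors k)
      first-row : ∀ x xs → (if does (P? x) then card (vectors k) else 0) + count P? xs * card (vectors k)
                           ≡ count P? (x ∷ xs) * card (vectors k)
      first-row x xs with does (P? x)
      ... | true  = refl
      ... | false = refl
      go : ∀ xs → count (λ v → P? (head v)) (cartesianProductWith _∷ᵛ_ xs vs) ≡ count P? xs * card (vectors k)
      go []       = refl
      go (x ∷ xs) = begin
        count (λ v → P? (head v)) (map (x ∷ᵛ_) vs ++ cartesianProductWith _∷ᵛ_ xs vs)
          ≡⟨ count-++ (λ v → P? (head v)) (map (x ∷ᵛ_) vs) _ ⟩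
        count (λ v → P? (head v)) (map (x ∷ᵛ_) vs) + count (λ v → P? (head v)) (cartesianProductWith _∷ᵛ_ xs vs)
          ≡⟨ cong₂ _+_ (trans (count-map (λ v → P? (head v)) (x ∷ᵛ_) vs) (count-const (P? x) vs)) (go xs) ⟩
        (if does (P? x) then card (vectors k) else 0) + count P? xs * card (vectors k)
          ≡⟨ first-row x xs ⟩
        count P? (x ∷ xs) * card (vectors k) ∎
        where open ≡-Reasoning

  count-image-≥ : ∀ {a ℓ b p} {S : Setoid a ℓ} (E : Enumeration S) {B : Set b} (f : B → Setoid.Carrier S) →
                  ∀ {xs} → AllPairs (λ x y → ¬ Setoid._≈_ S (f x) (f y)) xs → card E ≤ length xs →
                  {P : Pred (Setoid.Carrier S) p} (P? : Decidable P) → P Respects (Setoid._≈_ S) →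
                  count P? (elements E) ≤ count (λ x → P? (f x)) xs
  count-image-≥ {S = S} E f {xs} images-distinct card≤ P? resp = begin
    count P? (elements E)          ≤⟨ count-antimono-⊆ S P? resp (AllPairsₚ.map⁺ images-distinct)
                                        (λ {v} _ → complete E v) (≡.subst (card E ≤_) (≡.sym (length-map f xs)) card≤) ⟩
    count P? (map f xs)            ≡⟨ count-map P? f xs ⟩
    count (λ x → P? (f x)) xs      ∎
    where open ≤-Reasoning

module LinearAlgebra {c ℓ} (R : CommutativeRing c ℓ) where

  open import Data.Nat using (zero; suc)
  open import Data.Fin using (Fin; zero; suc; punchIn; _≟_)
  open import Data.Fin.Properties using (punchInᵢ≢i)
  open import Data.Empty using (⊥-elim)
  open import Relation.Binary.PropositionalEquality as ≡ using (_≡_)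
  open import Relation.Nullary using (yes; no)

  open CommutativeRing R hiding (zero)
  open Matrices R
  open import Algebra.Properties.Ring ring using (-1*x≈-x; [y-z]x≈yx-zx; x[y-z]≈xy-xz)
  open import Algebra.Properties.Group +-group using (x∙y⁻¹≈ε⇒x≈y; x≈y⇒x∙y⁻¹≈ε)
  open import Algebra.Properties.Semiring.Sum semiring
    using (sum; sum-cong-≋; ∑-distrib-+; ∑-comm; sum-remove; *-distribˡ-sum; *-distribʳ-sum)
  open import Relation.Binary.Reasoning.Setoid setoid

  sumF≡sum : ∀ k f → sumF k f ≡ sum f
  sumF≡sum zero    f = ≡.refl
  sumF≡sum (suc k) f = ≡.cong (f zero +_) (sumF≡sum k (λ i → f (suc i)))

  sumF-cong : ∀ k {f g : Fin k → Carrier} → (∀ i → f i ≈ g i) → sumF k f ≈ sumF k g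
  sumF-cong zero    f≈g = refl
  sumF-cong (suc k) f≈g = +-cong (f≈g zero) (sumF-cong k (λ i → f≈g (suc i)))

  sumF-zero : ∀ k {f : Fin k → Carrier} → (∀ i → f i ≈ 0#) → sumF k f ≈ 0#
  sumF-zero zero    f≈0 = refl
  sumF-zero (suc k) f≈0 = trans (+-cong (f≈0 zero) (sumF-zero k (λ i → f≈0 (suc i)))) (+-identityʳ 0#)

  sumF-+ : ∀ k (f g : Fin k → Carrier) → sumF k (λ i → f i + g i) ≈ sumF k f + sumF k g
  sumF-+ k f g = begin
    sumF k (λ i → f i + g i) ≡⟨ sumF≡sum k _ ⟩
    sum (λ i → f i + g i)    ≈⟨ ∑-distrib-+ f g ⟩
    sum f + sum g            ≡⟨ ≡.sym (≡.cong₂ _+_ (sumF≡sum k f) (sumF≡sum k g)) ⟩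
    sumF k f + sumF k g      ∎

  sumF-*ˡ : ∀ k a (f : Fin k → Carrier) → sumF k (λ i → a * f i) ≈ a * sumF k f
  sumF-*ˡ k a f = begin
    sumF k (λ i → a * f i) ≡⟨ sumF≡sum k _ ⟩
    sum (λ i → a * f i)    ≈⟨ sym (*-distribˡ-sum a f) ⟩
    a * sum f              ≡⟨ ≡.cong (a *_) (≡.sym (sumF≡sum k f)) ⟩
    a * sumF k f           ∎

  sumF-*ʳ : ∀ k a (f : Fin k → Carrier) → sumF k (λ i → f i * a) ≈ sumF k f * a
  sumF-*ʳ k a f = begin
    sumF k (λ i → f i * a) ≡⟨ sumF≡sum k _ ⟩
    sum (λ i → f i * a)    ≈⟨ sym (*-distribʳ-sum a f) ⟩
    sum f * a              ≡⟨ ≡.cong (_* a) (≡.sym (sumF≡sum k f)) ⟩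
    sumF k f * a           ∎

  sumF-comm : ∀ k l (f : Fin k → Fin l → Carrier) →
              sumF k (λ i → sumF l (f i)) ≈ sumF l (λ j → sumF k (λ i → f i j))
  sumF-comm zero    l f = sym (sumF-zero l (λ _ → refl))
  sumF-comm (suc k) l f = begin
    sumF l (f zero) + sumF k (λ i → sumF l (f (suc i)))           ≈⟨ +-congˡ (sumF-comm k l (λ i → f (suc i))) ⟩
    sumF l (f zero) + sumF l (λ j → sumF k (λ i → f (suc i) j))   ≈⟨ sym (sumF-+ l (f zero) _) ⟩
    sumF l (λ j → f zero j + sumF k (λ i → f (suc i) j))           ∎

  sumF-remove : ∀ k (p : Fin (suc k)) (f : Fin (suc k) → Carrier) →
                sumF (suc k) f ≈ f p + sumF k (λ s → f (punchIn p s))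
  sumF-remove k p f = begin
    sumF (suc k) f                         ≡⟨ sumF≡sum (suc k) f ⟩
    sum f                                  ≈⟨ sum-remove f ⟩
    f p + sum (λ s → f (punchIn p s))      ≡⟨ ≡.cong (f p +_) (≡.sym (sumF≡sum k _)) ⟩
    f p + sumF k (λ s → f (punchIn p s))   ∎

  sumF-neg : ∀ k (f : Fin k → Carrier) → sumF k (λ i → - f i) ≈ - sumF k f
  sumF-neg k f = begin
    sumF k (λ i → - f i)      ≈⟨ sumF-cong k (λ i → sym (-1*x≈-x (f i))) ⟩
    sumF k (λ i → - 1# * f i) ≈⟨ sumF-*ˡ k (- 1#) f ⟩
    - 1# * sumF k f           ≈⟨ -1*x≈-x _ ⟩
    - sumF k f                ∎

  sumF-− : ∀ k (f g : Fin k → Carrier) → sumF k (λ i → f i - g i) ≈ sumF k f - sumF k g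
  sumF-− k f g = trans (sumF-+ k f (λ i → - g i)) (+-congˡ (sumF-neg k g))

  dot : ∀ {k} → Vector k → Vector k → Carrier
  dot u v = sumF _ (λ j → u j * v j)

  dot-congʳ : ∀ {k} (u : Vector k) {v v′ : Vector k} → v ≈V v′ → dot u v ≈ dot u v′
  dot-congʳ u v≈v′ = sumF-cong _ (λ j → *-congˡ (v≈v′ j))

  dot-zeroʳ : ∀ {k} (u : Vector k) {v : Vector k} → v ≈V zeroV → dot u v ≈ 0#
  dot-zeroʳ u v≈0 = sumF-zero _ (λ j → trans (*-congˡ (v≈0 j)) (zeroʳ (u j)))

  dot-−ˡ : ∀ {k} (u u′ v : Vector k) → dot (λ j → u j - u′ j) v ≈ dot u v - dot u′ v
  dot-−ˡ {k} u u′ v = trans (sumF-cong k (λ j → [y-z]x≈yx-zx (v j) (u j) (u′ j))) (sumF-− k _ _)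

  dot-−ʳ : ∀ {k} (u v v′ : Vector k) → dot u (λ j → v j - v′ j) ≈ dot u v - dot u v′
  dot-−ʳ {k} u v v′ = trans (sumF-cong k (λ j → x[y-z]≈xy-xz (u j) (v j) (v′ j))) (sumF-− k _ _)

  dot-·M : ∀ {m n} (α : Vector m) (A : Matrix m n) (b : Vector n) →
           dot (α ·M A) b ≈ dot α (λ i → dot (A i) b)
  dot-·M {m} {n} α A b = begin
    sumF n (λ j → sumF m (λ i → α i * A i j) * b j)    ≈⟨ sumF-cong n (λ j → sym (sumF-*ʳ m (b j) _)) ⟩
    sumF n (λ j → sumF m (λ i → (α i * A i j) * b j))  ≈⟨ sym (sumF-comm m n _) ⟩
    sumF m (λ i → sumF n (λ j → (α i * A i j) * b j))
      ≈⟨ sumF-cong m (λ i → sumF-cong n (λ j → *-assoc (α i) (A i j) (b j))) ⟩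
    sumF m (λ i → sumF n (λ j → α i * (A i j * b j)))  ≈⟨ sumF-cong m (λ i → sumF-*ˡ n (α i) _) ⟩
    sumF m (λ i → α i * dot (A i) b)                   ∎

  ·M-congʳ : ∀ {m n} (α : Vector m) {A B : Matrix m n} → A ≈M B → (α ·M A) ≈V (α ·M B)
  ·M-congʳ α A≈B j = dot-congʳ α (λ i → A≈B i j)

  ·M-assoc : ∀ {l m n} (α : Vector l) (A : Matrix l m) (B : Matrix m n) →
             ((α ·M A) ·M B) ≈V (α ·M (λ i → A i ·M B))
  ·M-assoc α A B j = dot-·M α A (λ r → B r j)

  unit : ∀ {k} → Fin k → Vector k
  unit i j with i ≟ j
  ... | yes _ = 1#
  ... | no  _ = 0#

  unit-·M : ∀ {k n} (i : Fin k) (A : Matrix k n) → (unit i ·M A) ≈V A i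
  unit-·M {suc k} i A j = begin
    (unit i ·M A) j                                           ≈⟨ sumF-remove k i (λ r → unit i r * A r j) ⟩
    unit i i * A i j + sumF k (λ s → unit i (punchIn i s) * A (punchIn i s) j)
      ≈⟨ +-cong (*-congʳ unit-diagonal) (sumF-zero k (λ s → trans (*-congʳ (unit-off s)) (zeroˡ _))) ⟩
    1# * A i j + 0#                                           ≈⟨ +-identityʳ _ ⟩
    1# * A i j                                                ≈⟨ *-identityˡ _ ⟩
    A i j                                                     ∎
    where
    unit-diagonal : unit i i ≈ 1#
    unit-diagonal with i ≟ i
    ... | yes _  = refl
    ... | no i≢i = ⊥-elim (i≢i ≡.refl)
    unit-off : ∀ s → unit i (punchIn i s) ≈ 0#
    unit-off s with i ≟ punchIn i s
    ... | yes i≡ = ⊥-elim (punchInᵢ≢i i s (≡.sym i≡))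
    ... | no  _  = refl

  dot-remove : ∀ {k} (p : Fin (suc k)) (u v : Vector (suc k)) →
               dot u v ≈ u p * v p + sumF k (λ s → u (punchIn p s) * v (punchIn p s))
  dot-remove {k} p u v = sumF-remove k p (λ j → u j * v j)

  dot-comm : ∀ {k} (u v : Vector k) → dot u v ≈ dot v u
  dot-comm u v = sumF-cong _ (λ j → *-comm (u j) (v j))

  x-y+y≈x : ∀ x y → (x - y) + y ≈ x
  x-y+y≈x x y = trans (+-assoc x (- y) y) (trans (+-congˡ (-‿inverseˡ y)) (+-identityʳ x))

  x-y≈0⇒x≈y : ∀ {x y} → x - y ≈ 0# → x ≈ y
  x-y≈0⇒x≈y = x∙y⁻¹≈ε⇒x≈y _ _

  x≈y⇒x-y≈0 : ∀ {x y} → x ≈ y → x - y ≈ 0#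
  x≈y⇒x-y≈0 = x≈y⇒x∙y⁻¹≈ε

module Field {c ℓ} (R : CommutativeRing c ℓ) (isField : IsField R) where

  open import Data.Nat using (suc)
  import Data.Nat as ℕ
  open import Data.Sum using (inj₁; inj₂)
  open import Data.Fin using (Fin; punchIn; _≟_; _↑ˡ_; _↑ʳ_; splitAt; join)
  open import Data.Fin.Properties using (punchIn-punchOut; join-splitAt)
  open import Data.Product using (proj₁; proj₂)
  open import Data.Vec.Functional using (insertAt)
  open import Data.Vec.Functional.Properties using (insertAt-lookup; insertAt-punchIn)
  open import Relation.Binary.PropositionalEquality as ≡ using (_≡_)
  open import Relation.Nullary using (yes; no)

  open CommutativeRing R hiding (zero)
  open Matrices R
  open IsField isField
  open import Algebra.Properties.Group +-group using (∙-cancelʳ)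
  open import Relation.Binary.Reasoning.Setoid setoid
  open LinearAlgebra R

  data PunchView {k} (p : Fin (suc k)) : Fin (suc k) → Set where
    pivot   : PunchView p p
    punched : (s : Fin k) → PunchView p (punchIn p s)

  punchView : ∀ {k} (p i : Fin (suc k)) → PunchView p i
  punchView p i with p ≟ i
  ... | yes ≡.refl = pivot
  ... | no  p≢i    = ≡.subst (PunchView p) (punchIn-punchOut p≢i) (punched _)

  data SplitView (k e : ℕ) : Fin (k ℕ.+ e) → Set where
    left  : (t : Fin k) → SplitView k e (t ↑ˡ e)
    right : (l : Fin e) → SplitView k e (k ↑ʳ l)

  splitView : ∀ k e (s : Fin (k ℕ.+ e)) → SplitView k e s
  splitView k e s = view (splitAt k s) (join-splitAt k e s)
    where
    view : ∀ i → join k e i ≡ s → SplitView k e s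
    view (inj₁ t) joins = ≡.subst (SplitView k e) joins (left t)
    view (inj₂ l) joins = ≡.subst (SplitView k e) joins (right l)

  *-cancelʳ-nonzero : ∀ {a} → ¬ a ≈ 0# → ∀ {x y} → x * a ≈ y * a → x ≈ y
  *-cancelʳ-nonzero {a} a≉0 {x} {y} xa≈ya = begin
    x              ≈⟨ sym (*-identityʳ x) ⟩
    x * 1#         ≈⟨ *-congˡ (sym a*a⁻¹≈1) ⟩
    x * (a * a⁻¹)  ≈⟨ sym (*-assoc x a a⁻¹) ⟩
    (x * a) * a⁻¹  ≈⟨ *-congʳ xa≈ya ⟩
    (y * a) * a⁻¹  ≈⟨ *-assoc y a a⁻¹ ⟩
    y * (a * a⁻¹)  ≈⟨ *-congˡ a*a⁻¹≈1 ⟩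
    y * 1#         ≈⟨ *-identityʳ y ⟩
    y              ∎
    where
    a⁻¹ : Carrier
    a⁻¹ = proj₁ (inverse a a≉0)
    a*a⁻¹≈1 : a * a⁻¹ ≈ 1#
    a*a⁻¹≈1 = proj₂ (inverse a a≉0)

  ≈V-from-dot : ∀ {k} {a : Vector (suc k)} {p} → ¬ a p ≈ 0# → ∀ {u v : Vector (suc k)} →
                dot u a ≈ dot v a → (∀ s → u (punchIn p s) ≈ v (punchIn p s)) → u ≈V v
  ≈V-from-dot {k} {a} {p} ap≉0 {u} {v} u·a≈v·a off i with punchView p i
  ... | punched s = off s
  ... | pivot     = *-cancelʳ-nonzero ap≉0 (∙-cancelʳ (sumF k (λ s → v (punchIn p s) * a (punchIn p s))) _ _ (begin
    u p * a p + sumF k (λ s → v (punchIn p s) * a (punchIn p s)) ≈⟨ +-congˡ (sumF-cong k (λ s → *-congʳ (sym (off s)))) ⟩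
    u p * a p + sumF k (λ s → u (punchIn p s) * a (punchIn p s)) ≈⟨ sym (dot-remove p u a) ⟩
    dot u a                                                     ≈⟨ u·a≈v·a ⟩
    dot v a                                                     ≈⟨ dot-remove p v a ⟩
    v p * a p + sumF k (λ s → v (punchIn p s) * a (punchIn p s)) ∎))

  -- The solution of z · a ≈ t whose coordinates away from the pivot p of z are those of b.
  solveAt : ∀ {k} (z : Vector (suc k)) p → ¬ z p ≈ 0# → Carrier → Vector k → Vector (suc k)
  solveAt {k} z p zp≉0 t b = insertAt b p (proj₁ (inverse (z p) zp≉0) * (t - sumF k (λ s → z (punchIn p s) * b s)))

  solveAt-punchIn : ∀ {k} (z : Vector (suc k)) p zp≉0 t b s → solveAt z p zp≉0 t b (punchIn p s) ≡ b s
  solveAt-punchIn z p zp≉0 t b s = insertAt-punchIn b p _ s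

  solveAt-solves : ∀ {k} (z : Vector (suc k)) p zp≉0 t b → dot z (solveAt z p zp≉0 t b) ≈ t
  solveAt-solves {k} z p zp≉0 t b = begin
    dot z a                                              ≈⟨ dot-remove p z a ⟩
    z p * a p + sumF k (λ s → z (punchIn p s) * a (punchIn p s))
      ≈⟨ +-cong (*-congˡ (reflexive (insertAt-lookup b p _)))
                (sumF-cong k (λ s → *-congˡ (reflexive (solveAt-punchIn z p zp≉0 t b s)))) ⟩
    z p * (w * (t - S)) + S                              ≈⟨ +-congʳ (sym (*-assoc (z p) w _)) ⟩
    (z p * w) * (t - S) + S                              ≈⟨ +-congʳ (*-congʳ (proj₂ (inverse (z p) zp≉0))) ⟩
    1# * (t - S) + S                                     ≈⟨ +-congʳ (*-identityˡ _) ⟩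
    (t - S) + S                                          ≈⟨ +-assoc t (- S) S ⟩
    t + (- S + S)                                        ≈⟨ +-congˡ (-‿inverseˡ S) ⟩
    t + 0#                                               ≈⟨ +-identityʳ t ⟩
    t                                                    ∎
    where
    a : Vector (suc k)
    a = solveAt z p zp≉0 t b
    w S : Carrier
    w = proj₁ (inverse (z p) zp≉0)
    S = sumF k (λ s → z (punchIn p s) * b s)

module FiniteField {c ℓ} (R : CommutativeRing c ℓ) (isField : IsField R) (q : ℕ) (hasCard : HasCard R q) where

  open import Data.Empty using (⊥-elim)
  open import Data.Nat using (suc; _≤_; _<_; _^_; _≤?_; z≤n; s≤s; >-nonZero)
  open import Data.Nat.Properties using (≤-antisym; ≤-trans; ^-monoʳ-<; <⇒≱; ≰⇒>; m^n>0)
  open import Data.Fin using (Fin; punchIn)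
  open import Data.Fin.Properties using (¬∀⟶∃¬; all?) renaming (_≟_ to _≟ᶠ_)
  open import Data.Product using (∃; _,_; proj₁; proj₂)
  open import Data.List using ([]; _∷_; map; filter; tabulate)
  open import Data.List.Properties using (length-map; length-tabulate)
  open import Data.List.Relation.Unary.All using ([]; _∷_)
  open import Data.List.Relation.Unary.All.Properties using (all-filter)
  open import Data.List.Relation.Unary.AllPairs using ([]; _∷_)
  import Data.List.Relation.Unary.AllPairs as AllPairs
  import Data.List.Relation.Unary.AllPairs.Properties as AllPairsₚ
  import Data.List.Membership.Setoid.Properties as SetoidMembershipₚ
  import Data.List.Relation.Unary.Unique.Setoid.Properties as SetoidUniqueₚ
  open import Data.Vec.Functional.Relation.Binary.Equality.Setoid using (≋-setoid)
  open import Relation.Binary.Bundles using (Setoid)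
  open import Data.List.Relation.Binary.Subset.Setoid using (_⊆_)
  open import Relation.Binary.Definitions using (Decidable)
  open import Relation.Binary.PropositionalEquality as ≡ using (_≡_)
  open import Relation.Nullary using (yes; no)

  open CommutativeRing R hiding (zero)
  open Matrices R
  open IsField isField
  open HasCard hasCard
  open Counting
  open Enumerations
  open LinearAlgebra R
  open Field R isField

  V-setoid : ℕ → Setoid c ℓ
  V-setoid = ≋-setoid setoid

  infix 4 _≟_ _≟V_

  _≟_ : Decidable _≈_
  x ≟ y with proj₁ (enum-surj x) ≟ᶠ proj₁ (enum-surj y)
  ... | yes i≡j = yes (trans (sym (proj₂ (enum-surj x))) (trans (reflexive (≡.cong enum i≡j)) (proj₂ (enum-surj y))))
  ... | no  i≢j = no (λ x≈y → i≢j (enum-inj _ _ (trans (proj₂ (enum-surj x)) (trans x≈y (sym (proj₂ (enum-surj y)))))))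

  _≟V_ : ∀ {k} → Decidable (_≈V_ {k})
  u ≟V v = all? (λ i → u i ≟ v i)

  nonzero-coordinate : ∀ {k} {u : Vector k} → ¬ u ≈V zeroV → ∃ λ j → ¬ u j ≈ 0#
  nonzero-coordinate {k} {u} u≉0 = ¬∀⟶∃¬ k (λ j → u j ≈ 0#) (λ j → u j ≟ 0#) u≉0

  scalars : Enumeration setoid
  elements scalars = tabulate enum
  unique   scalars = SetoidUniqueₚ.tabulate⁺ setoid (enum-inj _ _)
  complete scalars x = SetoidMembershipₚ.∈-resp-≈ setoid (proj₂ (enum-surj x))
                         (SetoidMembershipₚ.∈-tabulate⁺ setoid (proj₁ (enum-surj x)))

  card-scalars : card scalars ≡ q
  card-scalars = length-tabulate enum

  2≤q : 2 ≤ q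
  2≤q = ≡.subst (2 ≤_) card-scalars
    (Unique-⊆⇒length≤ setoid ((0≉1 ∷ []) ∷ [] ∷ []) (λ {x} _ → complete scalars x))

  ^-cancelˡ-≤ : ∀ {s e} → q ^ s ≤ q ^ e → s ≤ e
  ^-cancelˡ-≤ {s} {e} q^s≤q^e with s ≤? e
  ... | yes s≤e = s≤e
  ... | no  s≰e = ⊥-elim (<⇒≱ (^-monoʳ-< q 2≤q (≰⇒> s≰e)) q^s≤q^e)

  Vectors : ∀ k → Enumeration (V-setoid k)
  Vectors = vectors scalars

  card-Vectors : ∀ k → card (Vectors k) ≡ q ^ k
  card-Vectors k = ≡.trans (card-vectors scalars k) (≡.cong (_^ k) card-scalars)

  -- Deleting the pivot coordinate of z and solveAt are mutually inverse injections
  -- between the solutions of z · a ≈ t and F^k.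
  count-hyperplane : ∀ {k} {z : Vector (suc k)} → ¬ z ≈V zeroV → ∀ t →
                     count (λ a → dot z a ≟ t) (elements (Vectors (suc k))) ≡ q ^ k
  count-hyperplane {k} {z} z≉0 t = ≤-antisym
    (≡.subst₂ _≤_ (length-map drop-pivot solutions) (card-Vectors k)
      (Unique-⊆⇒length≤ (V-setoid k) dropped-unique (λ {u} _ → complete (Vectors k) u)))
    (≡.subst₂ _≤_ (≡.trans (length-map insert (elements (Vectors k))) (card-Vectors k)) ≡.refl
      (Unique-⊆⇒length≤ (V-setoid (suc k)) inserted-unique inserted⊆solutions))
    where
    p : Fin (suc k)
    p = proj₁ (nonzero-coordinate z≉0)
    zp≉0 : ¬ z p ≈ 0#
    zp≉0 = proj₂ (nonzero-coordinate z≉0)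
    solves : Vector (suc k) → Set ℓ
    solves a = dot z a ≈ t
    solutions : List (Vector (suc k))
    solutions = filter (λ a → dot z a ≟ t) (elements (Vectors (suc k)))

    drop-pivot : Vector (suc k) → Vector k
    drop-pivot a s = a (punchIn p s)
    dropped-unique : AllPairs.AllPairs (λ u v → ¬ u ≈V v) (map drop-pivot solutions)
    dropped-unique = AllPairsₚ.map⁺ (AllPairs-map-under-All
      (λ {a} {b} z·a≈t z·b≈t a≉b a∘p≈b∘p →
        a≉b (≈V-from-dot {a = z} zp≉0 (trans (dot-comm a z) (trans z·a≈t (trans (sym z·b≈t) (dot-comm z b)))) a∘p≈b∘p))
      (all-filter (λ a → dot z a ≟ t) (elements (Vectors (suc k))))
      (SetoidUniqueₚ.filter⁺ (V-setoid (suc k)) (λ a → dot z a ≟ t) (unique (Vectors (suc k)))))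

    insert : Vector k → Vector (suc k)
    insert = solveAt z p zp≉0 t
    inserted-unique : AllPairs.AllPairs (λ u v → ¬ u ≈V v) (map insert (elements (Vectors k)))
    inserted-unique = AllPairsₚ.map⁺ (AllPairs.map
      (λ b≉b′ eq → b≉b′ (λ s → trans (reflexive (≡.sym (solveAt-punchIn z p zp≉0 t _ s)))
                                (trans (eq (punchIn p s)) (reflexive (solveAt-punchIn z p zp≉0 t _ s)))))
      (unique (Vectors k)))
    solves-resp : ∀ {a b} → a ≈V b → solves a → solves b
    solves-resp a≈b z·a≈t = trans (sym (dot-congʳ z a≈b)) z·a≈t
    inserted⊆solutions : _⊆_ (V-setoid (suc k)) (map insert (elements (Vectors k))) solutions
    inserted⊆solutions {a} a∈ with b , _ , a≈insert-b ← SetoidMembershipₚ.∈-map⁻ (V-setoid k) (V-setoid (suc k)) a∈ =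
      SetoidMembershipₚ.∈-filter⁺ (V-setoid (suc k)) (λ a → dot z a ≟ t) solves-resp (complete (Vectors (suc k)) a)
        (solves-resp (λ i → sym (a≈insert-b i)) (solveAt-solves z p zp≉0 t b))

  LinIndep-injective : ∀ {s n} {v : Matrix s n} → LinIndep v → ∀ {α β} → (α ·M v) ≈V (β ·M v) → α ≈V β
  LinIndep-injective {v = v} li {α} {β} α·v≈β·v i = x-y≈0⇒x≈y
    (li (λ i → α i - β i) (λ j → trans (dot-−ˡ α β (λ i → v i j)) (x≈y⇒x-y≈0 (α·v≈β·v j))) i)

  -- Independence makes α ↦ α·v injective, so a factorisation through F^e gives q^s ≤ q^e.
  LinIndep-≤ : ∀ {s e n} {v : Matrix s n} → LinIndep v → (g : Vector s → Vector e) →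
               (∀ {α β} → g α ≈V g β → (α ·M v) ≈V (β ·M v)) → s ≤ e
  LinIndep-≤ {s} {e} li g factor = ^-cancelˡ-≤ (≡.subst₂ _≤_
    (≡.trans (length-map g (elements (Vectors s))) (card-Vectors s)) (card-Vectors e)
    (Unique-⊆⇒length≤ (V-setoid e) images-unique (λ {u} _ → complete (Vectors e) u)))
    where
    images-unique : AllPairs.AllPairs (λ u v → ¬ u ≈V v) (map g (elements (Vectors s)))
    images-unique = AllPairsₚ.map⁺ (AllPairs.map (λ α≉β gα≈gβ → α≉β (LinIndep-injective li (factor gα≈gβ)))
                                                 (unique (Vectors s)))

  q^-positive : ∀ j → 0 < q ^ j
  q^-positive = m^n>0 q {{>-nonZero (≤-trans (s≤s z≤n) 2≤q)}}

module Rank {c ℓ} (R : CommutativeRing c ℓ) (isField : IsField R) (q : ℕ) (hasCard : HasCard R q) where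

  open import Level using (_⊔_)
  open import Data.Nat using (zero; suc; _≤_)
  import Data.Nat as ℕ
  import Data.Nat.Properties as ℕ
  open import Data.Fin using (Fin; zero; suc; punchIn; _↑ˡ_; _↑ʳ_)
  open import Data.Fin.Properties using (¬∀⟶∃¬; injective⇒≤)
  open import Data.Product using (∃; _,_; proj₁; proj₂)
  open import Data.List.Relation.Unary.Any as Any using ()
  open import Data.List.Relation.Unary.All as All using (All)
  open import Data.List.Relation.Unary.AllPairs using (AllPairs)
  import Relation.Binary.PropositionalEquality as ≡

  open CommutativeRing R hiding (zero)
  open Matrices R
  open import Algebra.Properties.CommutativeSemigroup *-commutativeSemigroup using (xy∙z≈xz∙y)
  open import Relation.Binary.Reasoning.Setoid setoid
  open Counting
  open LinearAlgebra R
  open Field R isField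
  open FiniteField R isField q hasCard

  RankAtMost : ∀ {m n} → Matrix m n → ℕ → Set (c ⊔ ℓ)
  RankAtMost A e = ∀ s → RankAtLeast A s → s ≤ e

  RankAtLeast-0 : ∀ {m n} (A : Matrix m n) → RankAtLeast A 0
  RankAtLeast-0 A = (λ ()) , (λ { {()} }) , (λ _ _ ())

  RankAtLeast-1 : ∀ {m n} {A B : Matrix m n} → ¬ A ≈M B → RankAtLeast (A -M B) 1
  RankAtLeast-1 {m} {n} {A} {B} A≉B = (λ _ → i) , (λ { {zero} {zero} _ → ≡.refl }) , independent
    where
    row : ∃ λ i → ¬ A i ≈V B i
    row = ¬∀⟶∃¬ m (λ i → A i ≈V B i) (λ i → A i ≟V B i) A≉B
    i = proj₁ row
    entry : ∃ λ j → ¬ A i j ≈ B i j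
    entry = ¬∀⟶∃¬ n (λ j → A i j ≈ B i j) (λ j → A i j ≟ B i j) (proj₂ row)
    j = proj₁ entry
    Dij≉0 : ¬ (A i j - B i j) ≈ 0#
    Dij≉0 Dij≈0 = proj₂ entry (x-y≈0⇒x≈y Dij≈0)
    independent : LinIndep (λ (_ : Fin 1) → (A -M B) i)
    independent a a·D≈0 zero = *-cancelʳ-nonzero Dij≉0 (trans (sym (+-identityʳ _)) (trans (a·D≈0 j) (sym (zeroˡ _))))

  RankAtLeast-≤-rows : ∀ {m n d} {A : Matrix m n} → RankAtLeast A d → d ≤ m
  RankAtLeast-≤-rows (_ , σ-injective , _) = injective⇒≤ σ-injective

  RankAtLeast-≤-columns : ∀ {m n d} {A : Matrix m n} → RankAtLeast A d → d ≤ n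
  RankAtLeast-≤-columns (_ , _ , independent) = LinIndep-≤ independent (λ α → α ·M _) (λ eq → eq)

  RankAtMost-factor : ∀ {m n e} (D : Matrix m n) (h : Vector m → Vector e) →
                      (∀ γ γ′ → h γ ≈V h γ′ → (γ ·M D) ≈V (γ′ ·M D)) → RankAtMost D e
  RankAtMost-factor {m} D h factor s (σ , _ , independent) =
    LinIndep-≤ independent (λ α → h (spread α))
      (λ {α} {β} h≈ j → trans (sym (spread-·M α j)) (trans (factor (spread α) (spread β) h≈ j) (spread-·M β j)))
    where
    spread : Vector s → Vector m
    spread α = α ·M (λ i → unit (σ i))
    spread-·M : ∀ α → (spread α ·M D) ≈V (α ·M (λ i → D (σ i)))
    spread-·M α j = trans (·M-assoc α (λ i → unit (σ i)) D j) (·M-congʳ α (λ i → unit-·M (σ i) D) j)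

  -- MinDist speaks of the exact rank (HasRank), which is available only up to double negation.
  MinDist⇒¬RankAtMost : ∀ {m n e} {C : List (Matrix m n)} → MinDist C (suc e) →
                        ∀ {A B} → A ∈C C → B ∈C C → ¬ A ≈M B → ¬ RankAtMost (A -M B) e
  MinDist⇒¬RankAtMost (_ , d≤rank) {A} {B} A∈C B∈C A≉B rank≤e =
    ¬¬-last (RankAtLeast (A -M B)) _ (RankAtLeast-0 (A -M B)) rank≤e
      (λ (r , ≥r , ≱r+1) → ℕ.<⇒≱ (d≤rank A B r A∈C B∈C A≉B (≥r , ≱r+1)) (rank≤e r ≥r))

  -- As x · D ≈ 0, the combination γ · D is determined by the residuals γ r x p − γ p x r,
  -- which vanish at the pivot row p and do not matter on the k vanishing rows of D.
  RankAtMost-rows : ∀ {k e n} {x : Vector (suc (k ℕ.+ e))} {p} → ¬ x p ≈ 0# →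
                    {D : Matrix (suc (k ℕ.+ e)) n} → (x ·M D) ≈V zeroV →
                    (∀ t → D (punchIn p (t ↑ˡ e)) ≈V zeroV) → RankAtMost D e
  RankAtMost-rows {k} {e} {n} {x} {p} xp≉0 {D} x·D≈0 D-fixed≈0 =
    RankAtMost-factor D (λ γ l → residual γ (punchIn p (k ↑ʳ l))) factor
    where
    m : ℕ
    m = suc (k ℕ.+ e)
    residual : Vector m → Vector m
    residual γ r = γ r * x p - γ p * x r

    split-off-x : ∀ γ r j → (γ r * D r j) * x p ≈ residual γ r * D r j + γ p * (x r * D r j)
    split-off-x γ r j = begin
      (γ r * D r j) * x p                         ≈⟨ xy∙z≈xz∙y (γ r) (D r j) (x p) ⟩
      (γ r * x p) * D r j                         ≈⟨ *-congʳ (sym (x-y+y≈x (γ r * x p) (γ p * x r))) ⟩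
      (residual γ r + γ p * x r) * D r j          ≈⟨ distribʳ (D r j) _ _ ⟩
      residual γ r * D r j + (γ p * x r) * D r j  ≈⟨ +-congˡ (*-assoc (γ p) (x r) (D r j)) ⟩
      residual γ r * D r j + γ p * (x r * D r j)  ∎

    scaled : ∀ γ j → (γ ·M D) j * x p ≈ sumF m (λ r → residual γ r * D r j)
    scaled γ j = begin
      (γ ·M D) j * x p                                          ≈⟨ sym (sumF-*ʳ m (x p) (λ r → γ r * D r j)) ⟩
      sumF m (λ r → (γ r * D r j) * x p)                        ≈⟨ sumF-cong m (λ r → split-off-x γ r j) ⟩
      sumF m (λ r → residual γ r * D r j + γ p * (x r * D r j))
        ≈⟨ sumF-+ m (λ r → residual γ r * D r j) (λ r → γ p * (x r * D r j)) ⟩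
      Σres + sumF m (λ r → γ p * (x r * D r j))                 ≈⟨ +-congˡ (sumF-*ˡ m (γ p) (λ r → x r * D r j)) ⟩
      Σres + γ p * (x ·M D) j                                   ≈⟨ +-congˡ (trans (*-congˡ (x·D≈0 j)) (zeroʳ (γ p))) ⟩
      Σres + 0#                                                 ≈⟨ +-identityʳ Σres ⟩
      Σres                                                      ∎
      where Σres = sumF m (λ r → residual γ r * D r j)

    factor : ∀ γ γ′ → (λ l → residual γ (punchIn p (k ↑ʳ l))) ≈V (λ l → residual γ′ (punchIn p (k ↑ʳ l))) →
             (γ ·M D) ≈V (γ′ ·M D)
    factor γ γ′ free≈ j = *-cancelʳ-nonzero xp≉0 (trans (scaled γ j) (trans (sumF-cong m same-term) (sym (scaled γ′ j))))
      where
      same-term : ∀ r → residual γ r * D r j ≈ residual γ′ r * D r j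
      same-term r with punchView p r
      ... | pivot = trans (*-congʳ (-‿inverseʳ (γ p * x p))) (sym (*-congʳ (-‿inverseʳ (γ′ p * x p))))
      ... | punched s with splitView k e s
      ...   | left t  = trans (*-congˡ (D-fixed≈0 t j)) (trans (zeroʳ _) (sym (trans (*-congˡ (D-fixed≈0 t j)) (zeroʳ _))))
      ...   | right l = *-congʳ (free≈ l)

  -- Every combination of rows of D vanishes on the k vanishing columns and is orthogonal to a,
  -- so it is determined by its e remaining coordinates off the pivot of a.
  RankAtMost-columns : ∀ {m k e} {a : Vector (suc (k ℕ.+ e))} {p} → ¬ a p ≈ 0# →
                       {D : Matrix m (suc (k ℕ.+ e))} → (∀ i → dot (D i) a ≈ 0#) →
                       (∀ i t → D i (punchIn p (t ↑ˡ e)) ≈ 0#) → RankAtMost D e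
  RankAtMost-columns {m} {k} {e} {a} {p} ap≉0 {D} D·a≈0 D-fixed≈0 =
    RankAtMost-factor D (λ γ l → (γ ·M D) (punchIn p (k ↑ʳ l))) factor
    where
    combination-fixed : ∀ γ t → (γ ·M D) (punchIn p (t ↑ˡ e)) ≈ 0#
    combination-fixed γ t = sumF-zero m (λ i → trans (*-congˡ (D-fixed≈0 i t)) (zeroʳ (γ i)))

    combination-kernel : ∀ γ → dot (γ ·M D) a ≈ 0#
    combination-kernel γ = trans (dot-·M γ D a) (dot-zeroʳ γ D·a≈0)

    factor : ∀ γ γ′ → (λ l → (γ ·M D) (punchIn p (k ↑ʳ l))) ≈V (λ l → (γ′ ·M D) (punchIn p (k ↑ʳ l))) →
             (γ ·M D) ≈V (γ′ ·M D)
    factor γ γ′ free≈ = ≈V-from-dot {a = a} ap≉0 (trans (combination-kernel γ) (sym (combination-kernel γ′))) off-pivot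
      where
      off-pivot : ∀ s → (γ ·M D) (punchIn p s) ≈ (γ′ ·M D) (punchIn p s)
      off-pivot s with splitView k e s
      ... | left t  = trans (combination-fixed γ t) (sym (combination-fixed γ′ t))
      ... | right l = free≈ l

  codeword-images-distinct : ∀ {m n r s e} {C : List (Matrix m n)} → Distinct C → MinDist C (suc e) →
                             (Φ : Matrix m n → Matrix r s) → (∀ A B → Φ A ≈M Φ B → RankAtMost (A -M B) e) →
                             AllPairs (λ A B → ¬ Φ A ≈M Φ B) C
  codeword-images-distinct distinct minDist Φ collapse =
    AllPairs-map-under-All
      (λ {A} {B} A∈C B∈C A≉B ΦA≈ΦB → MinDist⇒¬RankAtMost minDist A∈C B∈C A≉B (collapse A B ΦA≈ΦB))
      (All.tabulate (Any.map (λ { ≡.refl i j → refl }))) distinct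

module MRD {c ℓ} (R : CommutativeRing c ℓ) (isField : IsField R) (q : ℕ) (hasCard : HasCard R q) where

  import Data.Nat as ℕ
  open import Data.Nat using (zero; suc; _≤_; _<_; _^_; _∸_)
  import Data.Nat.Properties as ℕ
  open import Data.Empty using (⊥-elim)
  open import Data.Fin using (Fin; zero; suc; punchIn; _↑ˡ_)
  open import Data.Product using (_,_; proj₁; proj₂)
  open import Data.List using (length; map)
  open import Data.Nat.ListAction using (sum)
  open import Data.List.Relation.Unary.All as All using ()
  open import Data.List.Relation.Unary.All.Properties using (¬Any⇒All¬)
  open import Data.List.Relation.Unary.Any as Any using (Any)
  open import Data.Vec.Functional.Relation.Binary.Equality.Setoid using (≋-setoid)
  open import Relation.Binary.PropositionalEquality as ≡ using (_≡_)
  open import Relation.Nullary using (Dec; yes; no)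

  open CommutativeRing R hiding (zero)
  open Matrices R
  open import Algebra.Properties.CommutativeSemigroup ℕ.*-commutativeSemigroup using (xy∙z≈xz∙y)
  open Counting
  open Enumerations
  open LinearAlgebra R
  open FiniteField R isField q hasCard
  open Rank R isField q hasCard

  solvable-rows : ∀ {m n} k e → m ≡ suc (k ℕ.+ e) → {C : List (Matrix m n)} → Distinct C → MinDist C (suc e) →
                  length C ≡ (q ^ n) ^ suc k → {x : Vector m} → ¬ x ≈V zeroV → (y : Vector n) →
                  Any (λ M → (x ·M M) ≈V y) C
  solvable-rows {n = n} k e ≡.refl {C} distinct minDist |C| {x} x≉0 y =
    count-pos⇒Any (λ M → P? (Φ M)) C (ℕ.≤-trans target-hit
      (count-image-≥ T Φ (codeword-images-distinct distinct minDist Φ collapse)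
        (ℕ.≤-reflexive (≡.trans card-T (≡.sym |C|))) P? P-resp))
    where
    p : Fin (suc (k ℕ.+ e))
    p = proj₁ (nonzero-coordinate x≉0)

    Φ : Matrix (suc (k ℕ.+ e)) n → Matrix (suc k) n
    Φ M zero    = x ·M M
    Φ M (suc t) = M (punchIn p (t ↑ˡ e))

    collapse : ∀ A B → Φ A ≈M Φ B → RankAtMost (A -M B) e
    collapse A B ΦA≈ΦB = RankAtMost-rows {x = x} {p = p} (proj₂ (nonzero-coordinate x≉0)) {D = A -M B}
      (λ j → trans (dot-−ʳ x (λ i → A i j) (λ i → B i j)) (x≈y⇒x-y≈0 (ΦA≈ΦB zero j)))
      (λ t j → x≈y⇒x-y≈0 (ΦA≈ΦB (suc t) j))

    T : Enumeration (≋-setoid (V-setoid n) (suc k))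
    T = vectors (Vectors n) (suc k)

    card-T : card T ≡ (q ^ n) ^ suc k
    card-T = ≡.trans (card-vectors (Vectors n) (suc k)) (≡.cong (_^ suc k) (card-Vectors n))

    P? : (z : Matrix (suc k) n) → Dec (z zero ≈V y)
    P? z = z zero ≟V y

    P-resp : ∀ {z z′} → z ≈M z′ → z zero ≈V y → z′ zero ≈V y
    P-resp z≈z′ z₀≈y j = trans (sym (z≈z′ zero j)) (z₀≈y j)

    target-hit : 0 < count P? (elements T)
    target-hit = Any⇒count-pos P? (Any.map (λ y≈z j → sym (y≈z zero j)) (complete T (λ _ → y)))

  module Columns {m′ k e} {C : List (Matrix (suc m′) (suc (k ℕ.+ e)))} (distinct : Distinct C)
                 (minDist : MinDist C (suc e)) (|C| : length C ≡ (q ^ suc m′) ^ suc k)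
                 {x : Vector (suc m′)} (x≉0 : ¬ x ≈V zeroV) (y : Vector (suc (k ℕ.+ e))) where

    m n : ℕ
    m = suc m′
    n = suc (k ℕ.+ e)

    agrees? : (a : Vector n) (M : Matrix m n) → Dec (dot (x ·M M) a ≈ dot y a)
    agrees? a M = dot (x ·M M) a ≟ dot y a

    hits : Vector n → ℕ
    hits a = count (agrees? a) C

    -- = |C| / q
    bound : ℕ
    bound = q ^ m′ ℕ.* (q ^ m) ^ k

    hits-nonzero : ∀ {a} → ¬ a ≈V zeroV → bound ≤ hits a
    hits-nonzero {a} a≉0 = begin
      bound                                     ≡⟨ ≡.sym count-T ⟩
      count P? (elements T)                     ≤⟨ count-image-≥ T Φ (codeword-images-distinct distinct minDist Φ collapse)
                                                     (ℕ.≤-reflexive (≡.trans card-T (≡.sym |C|))) P? P-resp ⟩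
      count (λ M → P? (Φ M)) C                  ≤⟨ count-mono (λ M → P? (Φ M)) (agrees? a) (λ M → trans (dot-·M x M a)) C ⟩
      hits a                                    ∎
      where
      open ℕ.≤-Reasoning
      p : Fin n
      p = proj₁ (nonzero-coordinate a≉0)

      Φ : Matrix m n → Matrix (suc k) m
      Φ M zero    i = dot (M i) a
      Φ M (suc t) i = M i (punchIn p (t ↑ˡ e))

      collapse : ∀ A B → Φ A ≈M Φ B → RankAtMost (A -M B) e
      collapse A B ΦA≈ΦB = RankAtMost-columns {a = a} {p = p} (proj₂ (nonzero-coordinate a≉0)) {D = A -M B}
        (λ i → trans (dot-−ˡ (A i) (B i) a) (x≈y⇒x-y≈0 (ΦA≈ΦB zero i)))
        (λ i t → x≈y⇒x-y≈0 (ΦA≈ΦB (suc t) i))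

      T : Enumeration (≋-setoid (V-setoid m) (suc k))
      T = vectors (Vectors m) (suc k)

      card-T : card T ≡ (q ^ m) ^ suc k
      card-T = ≡.trans (card-vectors (Vectors m) (suc k)) (≡.cong (_^ suc k) (card-Vectors m))

      P? : (z : Matrix (suc k) m) → Dec (dot x (z zero) ≈ dot y a)
      P? z = dot x (z zero) ≟ dot y a

      P-resp : ∀ {z z′} → z ≈M z′ → dot x (z zero) ≈ dot y a → dot x (z′ zero) ≈ dot y a
      P-resp z≈z′ = trans (sym (dot-congʳ x (z≈z′ zero)))

      count-T : count P? (elements T) ≡ bound
      count-T = ≡.trans (count-head (Vectors m) (λ u → dot x u ≟ dot y a) k)
        (≡.cong₂ ℕ._*_ (count-hyperplane x≉0 (dot y a))
                      (≡.trans (card-vectors (Vectors m) k) (≡.cong (_^ k) (card-Vectors m))))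

    hits-zero : ∀ {a} → a ≈V zeroV → hits a ≡ length C
    hits-zero {a} a≈0 = count-all (agrees? a) (λ M → trans (dot-zeroʳ (x ·M M) a≈0) (sym (dot-zeroʳ y a≈0))) C

    misses : ∀ M → ¬ (x ·M M) ≈V y → count (λ a → agrees? a M) (elements (Vectors n)) ≤ q ^ (k ℕ.+ e)
    misses M xM≉y = ℕ.≤-trans
      (count-mono (λ a → agrees? a M) (λ a → dot z a ≟ 0#)
        (λ a xM·a≈y·a → trans (dot-−ˡ (x ·M M) y a) (x≈y⇒x-y≈0 xM·a≈y·a)) (elements (Vectors n)))
      (ℕ.≤-reflexive (count-hyperplane z≉0 0#))
      where
      z : Vector n
      z j = (x ·M M) j - y j
      z≉0 : ¬ z ≈V zeroV
      z≉0 z≈0 = xM≉y (λ j → x-y≈0⇒x≈y (z≈0 j))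

    |C|≡q*bound : length C ≡ q ℕ.* bound
    |C|≡q*bound = ≡.trans |C| (ℕ.*-assoc q (q ^ m′) ((q ^ m) ^ k))

    bound<|C| : bound < length C
    bound<|C| = ≡.subst (bound <_) (≡.trans (ℕ.*-comm bound q) (≡.sym |C|≡q*bound))
                        (ℕ.m<m*n bound q {{ℕ.>-nonZero bound-positive}} 2≤q)
      where
      bound-positive : 0 < bound
      bound-positive = ℕ.*-mono-≤ (q^-positive m′)
                         (≡.subst (0 <_) (≡.sym (ℕ.^-*-assoc q m k)) (q^-positive (m ℕ.* k)))

    at-least-bound : ∀ a → bound ≤ hits a
    at-least-bound a with a ≟V zeroV
    ... | yes a≈0 = ℕ.≤-trans (ℕ.<⇒≤ bound<|C|) (ℕ.≤-reflexive (≡.sym (hits-zero a≈0)))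
    ... | no  a≉0 = hits-nonzero a≉0

    solvable : Any (λ M → (x ·M M) ≈V y) C
    solvable with Any.any? (λ M → (x ·M M) ≟V y) C
    ... | yes solved  = solved
    ... | no unsolved = ⊥-elim (ℕ.<⇒≱ (ℕ.m<n⇒0<n∸m bound<|C|) excess≤0)
      where
      open ℕ.≤-Reasoning
      V : List (Vector n)
      V = elements (Vectors n)
      excess : ℕ
      excess = length C ∸ bound

      zero-hits-all : Any (λ a → bound ℕ.+ excess ≤ hits a) V
      zero-hits-all = Any.map
        (λ 0≈a → ℕ.≤-reflexive (≡.trans (ℕ.m+[n∸m]≡n (ℕ.<⇒≤ bound<|C|)) (≡.sym (hits-zero (λ j → sym (0≈a j))))))
        (complete (Vectors n) zeroV)

      excess≤0 : excess ≤ 0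
      excess≤0 = ℕ.+-cancelˡ-≤ (q ^ n ℕ.* bound) excess 0 (begin
        q ^ n ℕ.* bound ℕ.+ excess
          ≡⟨ ≡.cong (λ l → l ℕ.* bound ℕ.+ excess) (≡.sym (card-Vectors n)) ⟩
        length V ℕ.* bound ℕ.+ excess
          ≤⟨ sum-map-≥-with-excess at-least-bound zero-hits-all ⟩
        sum (map hits V)
          ≡⟨ sum-count-swap agrees? V C ⟩
        sum (map (λ M → count (λ a → agrees? a M) V) C)
          ≤⟨ sum-map-≤ (All.map (λ {M} → misses M) (¬Any⇒All¬ C unsolved)) ⟩
        length C ℕ.* q ^ (k ℕ.+ e)
          ≡⟨ ≡.cong (ℕ._* q ^ (k ℕ.+ e)) |C|≡q*bound ⟩
        (q ℕ.* bound) ℕ.* q ^ (k ℕ.+ e)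
          ≡⟨ xy∙z≈xz∙y q bound (q ^ (k ℕ.+ e)) ⟩
        q ^ n ℕ.* bound
          ≡⟨ ℕ.+-identityʳ _ ⟨
        q ^ n ℕ.* bound ℕ.+ 0 ∎)

  solvable-columns : ∀ {m n} m′ k e → m ≡ suc m′ → n ≡ suc (k ℕ.+ e) → {C : List (Matrix m n)} → Distinct C →
                     MinDist C (suc e) → length C ≡ (q ^ m) ^ suc k → {x : Vector m} → ¬ x ≈V zeroV → (y : Vector n) →
                     Any (λ M → (x ·M M) ≈V y) C
  solvable-columns m′ k e ≡.refl ≡.refl distinct minDist |C| x≉0 y = Columns.solvable distinct minDist |C| x≉0 y

  MRD-solvable : ∀ {m n} {C : List (Matrix m n)} → IsMRD q m n C → {x : Vector m} → ¬ x ≈V zeroV → (y : Vector n) →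
                 Any (λ M → (x ·M M) ≈V y) C
  MRD-solvable (_ , zero , ((_ , _ , _ , _ , A≉B , _ , ¬rank≥1) , _) , _) _ _ = ⊥-elim (¬rank≥1 (RankAtLeast-1 A≉B))
  MRD-solvable {m} {n} {C} (distinct , suc e , minDist@((A , B , _ , _ , _ , rank≥d , _) , _) , |C|) {x} x≉0 y =
    by-shape (m ℕ.≤? n)
    where
    d≤m⊓n : suc e ≤ m ℕ.⊓ n
    d≤m⊓n = ℕ.⊓-glb (RankAtLeast-≤-rows {A = A -M B} rank≥d) (RankAtLeast-≤-columns {A = A -M B} rank≥d)

    k : ℕ
    k = m ℕ.⊓ n ∸ suc e

    m⊓n≡ : m ℕ.⊓ n ≡ suc (k ℕ.+ e)
    m⊓n≡ = ≡.trans (≡.sym (ℕ.m∸n+n≡m d≤m⊓n)) (ℕ.+-suc k e)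

    |C|′ : length C ≡ (q ^ (m ℕ.⊔ n)) ^ suc k
    |C|′ = ≡.trans |C| (≡.trans (≡.cong (λ j → q ^ ((m ℕ.⊔ n) ℕ.* j)) (ℕ.+-comm k 1))
                                  (≡.sym (ℕ.^-*-assoc q (m ℕ.⊔ n) (suc k))))

    by-shape : Dec (m ≤ n) → Any (λ M → (x ·M M) ≈V y) C
    by-shape (yes m≤n) = solvable-rows k e (≡.trans (≡.sym (ℕ.m≤n⇒m⊓n≡m m≤n)) m⊓n≡) distinct minDist
      (≡.subst (λ l → length C ≡ (q ^ l) ^ suc k) (ℕ.m≤n⇒m⊔n≡n m≤n) |C|′) x≉0 y
    by-shape (no m≰n) = solvable-columns (ℕ.pred m) k e
      (≡.sym (ℕ.suc-pred m {{ℕ.>-nonZero (ℕ.≤-trans (ℕ.s≤s ℕ.z≤n) n<m)}}))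
      (≡.trans (≡.sym (ℕ.m≥n⇒m⊓n≡n (ℕ.<⇒≤ n<m))) m⊓n≡) distinct minDist
      (≡.subst (λ l → length C ≡ (q ^ l) ^ suc k) (ℕ.m≥n⇒m⊔n≡m (ℕ.<⇒≤ n<m)) |C|′) x≉0 y
      where
      n<m : n < m
      n<m = ℕ.≰⇒> m≰n

theorem5p1 : {c ℓ : Level} (F : CommutativeRing c ℓ) (q m n : ℕ)
    → IsField F → HasCard F q → IsPrimePower q
    → (C : List (Matrices.Matrix F m n)) → Matrices.IsMRD F q m n C
    → (x : Matrices.Vector F m) → ¬ (Matrices._≈V_ F x (Matrices.zeroV F))
    → (y : Matrices.Vector F n)
    → Σ (Matrices.Matrix F m n) λ M → Matrices._∈C_ F M C × Matrices._≈V_ F (Matrices._·M_ F x M) y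
theorem5p1 F q m n isField hasCard _ C isMRD x x≉0 y = find (MRD.MRD-solvable F isField q hasCard isMRD x≉0 y)
  where
  open import Data.Vec.Functional.Relation.Binary.Equality.Setoid using (≋-setoid)
  open import Data.List.Membership.Setoid (≋-setoid (≋-setoid (CommutativeRing.setoid F) n) m) using (find)
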